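{- Let $X$ be a finite set and let $f$ be a complementary choice function on $X$. Then there is a supermodular set-function $u:2^X\to\mathbb R$ which generates $f$, i.e. for every $A\subseteq X$, $f(A)$ is the least (by inclusion) subset of $A$ at which $u$ attains its maximum over all subsets of $A$.
   Context: A choice function (CF) on $X$ is a map $f:2^X\to 2^X$ with $f(A)\subseteq A$ for all $A$. A CF is consistent if $f(A)\subseteq B\subseteq A$ implies $f(B)=f(A)$; monotonic if $A\subseteq B$ implies $f(A)\subseteq f(B)$; complementary if consistent and monotonic. A set-function $u:2^X\to\mathbb R$ is supermodular if $u(A)+u(B)\le u(A\cap B)+u(A\cup B)$ for all $A,B\subseteq X$. For supermodular $u$, the set of maximizers of $u$ on $2^A$ is closed under union and intersection, so it has a least element with respect to inclusion; $u$ generates $f$ if $f(A)$ equals this least maximizer for every $A$. -}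

module Defs where

open import Data.Nat using (ℕ)
open import Data.Integer using (ℤ; _+_; _≤_)
open import Data.Fin.Subset using (Subset; _⊆_; _∩_; _∪_)
open import Data.Product using (_×_)
open import Relation.Binary.PropositionalEquality using (_≡_)

-- The finite ground set X is Fin n; 2^X is Subset n.

ChoiceFunction : ℕ → Set
ChoiceFunction n = Subset n → Subset n

IsCF : {n : ℕ} → ChoiceFunction n → Set
IsCF f = ∀ A → f A ⊆ A

Consistent : {n : ℕ} → ChoiceFunction n → Set
Consistent f = ∀ A B → f A ⊆ B → B ⊆ A → f B ≡ f A

Monotonic : {n : ℕ} → ChoiceFunction n → Set
Monotonic f = ∀ A B → A ⊆ B → f A ⊆ f B

Complementary : {n : ℕ} → ChoiceFunction n → Set
Complementary f = Consistent f × Monotonic f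

Supermodular : {n : ℕ} → (Subset n → ℤ) → Set
Supermodular u = ∀ A B → u A + u B ≤ u (A ∩ B) + u (A ∪ B)

IsMaximizer : {n : ℕ} → (Subset n → ℤ) → Subset n → Subset n → Set
IsMaximizer u A M = M ⊆ A × (∀ B → B ⊆ A → u B ≤ u M)

IsLeastMaximizer : {n : ℕ} → (Subset n → ℤ) → Subset n → Subset n → Set
IsLeastMaximizer u A M = IsMaximizer u A M × (∀ B → IsMaximizer u A B → M ⊆ B)

Generates : {n : ℕ} → (Subset n → ℤ) → ChoiceFunction n → Set
Generates u f = ∀ A → IsLeastMaximizer u A (f A)

{-# OPTIONS --safe #-}
module Submission where

open import Defs
open import Data.Nat using (ℕ; zero; suc; _+_; _≤_; z≤n; s≤s)
open import Data.Nat.Properties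
  using (≤-trans; +-mono-≤; +-monoˡ-≤; +-monoʳ-≤; +-cancelˡ-≤; +-cancelʳ-≤; m≤n+m; +-commutativeSemigroup;
         module ≤-Reasoning)
open import Algebra.Properties.CommutativeSemigroup +-commutativeSemigroup using (interchange)
open import Data.Integer using (ℤ; +_; +≤+)
open import Data.Integer.Properties using (drop‿+≤+)
open import Data.Bool using () renaming (_≟_ to _≟ᵇ_)
open import Data.Vec using (_∷_; [])
open import Data.Vec.Properties using (≡-dec)
open import Data.Fin.Subset using (Subset; _⊆_; _∩_; _∪_; inside; outside)
open import Data.Fin.Subset.Properties using (_⊆?_; ⊆-refl; ⊆-trans; x∈p∩q⁺; p⊆p∪q; q⊆p∪q)
open import Data.Product using (Σ; _×_; _,_; proj₁; proj₂)
open import Data.Sum using (_⊎_; inj₁; inj₂; [_,_])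
open import Data.Empty using (⊥-elim)
open import Function using (_∘_)
open import Relation.Nullary using (Dec; yes; no)
open import Relation.Unary using (Decidable)
open import Relation.Binary.PropositionalEquality using (_≡_; refl; sym; cong₂; subst; trans)

-- Take u B to be the number of fixed points S = f S of f with S ⊆ B. Each
-- B ↦ [S ⊆ B] is supermodular, hence so is u. If B ⊆ A then every fixed
-- S ⊆ B satisfies S = f S ⊆ f A by monotonicity, so f A maximizes u on 2^A.
-- By consistency f A is itself a fixed point, and a maximizer M ⊆ A can only
-- tie with f A if every fixed point below f A (in particular f A) lies in M.

∑ : {n : ℕ} → (Subset n → ℕ) → ℕ
∑ {zero}  g = g []
∑ {suc n} g = ∑ (g ∘ (outside ∷_)) + ∑ (g ∘ (inside ∷_))

∑-mono-≤ : {n : ℕ} {g k : Subset n → ℕ} → (∀ S → g S ≤ k S) → ∑ g ≤ ∑ k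
∑-mono-≤ {zero}  g≤k = g≤k []
∑-mono-≤ {suc n} g≤k = +-mono-≤ (∑-mono-≤ (g≤k ∘ (outside ∷_))) (∑-mono-≤ (g≤k ∘ (inside ∷_)))

∑-distrib-+ : {n : ℕ} (g k : Subset n → ℕ) → ∑ (λ S → g S + k S) ≡ ∑ g + ∑ k
∑-distrib-+ {zero}  g k = refl
∑-distrib-+ {suc n} g k =
  trans (cong₂ _+_ (∑-distrib-+ (g ∘ (outside ∷_)) (k ∘ (outside ∷_)))
                   (∑-distrib-+ (g ∘ (inside ∷_)) (k ∘ (inside ∷_))))
        (interchange (∑ (g ∘ (outside ∷_))) (∑ (k ∘ (outside ∷_)))
                     (∑ (g ∘ (inside ∷_))) (∑ (k ∘ (inside ∷_))))

+-mono-≤-tight : {a b c d : ℕ} → a ≤ c → b ≤ d → c + d ≤ a + b → c ≤ a × d ≤ b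
+-mono-≤-tight {a} {b} {c} {d} a≤c b≤d c+d≤a+b =
  +-cancelʳ-≤ d c a (≤-trans c+d≤a+b (+-monoʳ-≤ a b≤d)) ,
  +-cancelˡ-≤ c d b (≤-trans c+d≤a+b (+-monoˡ-≤ b a≤c))

∑-mono-≤-tight : {n : ℕ} {g k : Subset n → ℕ} → (∀ S → g S ≤ k S) → ∑ k ≤ ∑ g → ∀ S → k S ≤ g S
∑-mono-≤-tight {zero}  g≤k ∑k≤∑g [] = ∑k≤∑g
∑-mono-≤-tight {suc n} g≤k ∑k≤∑g (outside ∷ S) =
  ∑-mono-≤-tight (g≤k ∘ (outside ∷_))
    (proj₁ (+-mono-≤-tight (∑-mono-≤ (g≤k ∘ (outside ∷_))) (∑-mono-≤ (g≤k ∘ (inside ∷_))) ∑k≤∑g)) S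
∑-mono-≤-tight {suc n} g≤k ∑k≤∑g (inside ∷ S) =
  ∑-mono-≤-tight (g≤k ∘ (inside ∷_))
    (proj₂ (+-mono-≤-tight (∑-mono-≤ (g≤k ∘ (outside ∷_))) (∑-mono-≤ (g≤k ∘ (inside ∷_))) ∑k≤∑g)) S

indicator : {P : Set} → Dec P → ℕ
indicator (yes _) = 1
indicator (no _)  = 0

P⇒1≤indicator : {P : Set} (p : Dec P) → P → 1 ≤ indicator p
P⇒1≤indicator (yes _)  _ = s≤s z≤n
P⇒1≤indicator (no ¬x) x = ⊥-elim (¬x x)

indicator-mono : {P Q : Set} (p : Dec P) (q : Dec Q) → (P → Q) → indicator p ≤ indicator q
indicator-mono (yes x) q P⇒Q = P⇒1≤indicator q (P⇒Q x)
indicator-mono (no _)  q P⇒Q = z≤n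

indicator-mono⁻¹ : {P Q : Set} (p : Dec P) (q : Dec Q) → indicator p ≤ indicator q → P → Q
indicator-mono⁻¹ (yes _) (yes y) _  _ = y
indicator-mono⁻¹ (yes _) (no _)  () _
indicator-mono⁻¹ (no ¬x) q       _  x = ⊥-elim (¬x x)

indicator-supermodular : {P Q R S : Set} (p : Dec P) (q : Dec Q) (r : Dec R) (s : Dec S) →
  (P × Q → R) → (P ⊎ Q → S) → indicator p + indicator q ≤ indicator r + indicator s
indicator-supermodular (yes x) (yes y) r s ∧⇒R ∨⇒S =
  +-mono-≤ (P⇒1≤indicator r (∧⇒R (x , y))) (P⇒1≤indicator s (∨⇒S (inj₁ x)))
indicator-supermodular (yes x) (no _)  r s ∧⇒R ∨⇒S =
  ≤-trans (P⇒1≤indicator s (∨⇒S (inj₁ x))) (m≤n+m _ (indicator r))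
indicator-supermodular (no _)  (yes y) r s ∧⇒R ∨⇒S =
  ≤-trans (P⇒1≤indicator s (∨⇒S (inj₂ y))) (m≤n+m _ (indicator r))
indicator-supermodular (no _)  (no _)  r s ∧⇒R ∨⇒S = z≤n

module _ {n : ℕ} {F : Subset n → Set} (F? : Decidable F) where

  isBelow : Subset n → Subset n → ℕ
  isBelow B S with F? S
  ... | yes _ = indicator (S ⊆? B)
  ... | no _  = 0

  countBelow : Subset n → ℕ
  countBelow B = ∑ (isBelow B)

  isBelow-supermodular : ∀ A B S → isBelow A S + isBelow B S ≤ isBelow (A ∩ B) S + isBelow (A ∪ B) S
  isBelow-supermodular A B S with F? S
  ... | yes _ = indicator-supermodular (S ⊆? A) (S ⊆? B) (S ⊆? A ∩ B) (S ⊆? A ∪ B)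
                  (λ (S⊆A , S⊆B) x∈S → x∈p∩q⁺ (S⊆A x∈S , S⊆B x∈S))
                  [ (λ S⊆A x∈S → p⊆p∪q B (S⊆A x∈S)) , (λ S⊆B x∈S → q⊆p∪q A B (S⊆B x∈S)) ]
  ... | no _  = z≤n

  countBelow-supermodular : Supermodular (+_ ∘ countBelow)
  countBelow-supermodular A B = +≤+ (begin
    countBelow A + countBelow B
      ≡⟨ sym (∑-distrib-+ (isBelow A) (isBelow B)) ⟩
    ∑ (λ S → isBelow A S + isBelow B S)
      ≤⟨ ∑-mono-≤ (isBelow-supermodular A B) ⟩
    ∑ (λ S → isBelow (A ∩ B) S + isBelow (A ∪ B) S)
      ≡⟨ ∑-distrib-+ (isBelow (A ∩ B)) (isBelow (A ∪ B)) ⟩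
    countBelow (A ∩ B) + countBelow (A ∪ B) ∎)
    where open ≤-Reasoning

  module _ {B C : Subset n} (below⇒below : ∀ {S} → F S → S ⊆ B → S ⊆ C) where

    isBelow-mono : ∀ S → isBelow B S ≤ isBelow C S
    isBelow-mono S with F? S
    ... | yes FS = indicator-mono (S ⊆? B) (S ⊆? C) (below⇒below FS)
    ... | no _   = z≤n

    countBelow-mono : countBelow B ≤ countBelow C
    countBelow-mono = ∑-mono-≤ isBelow-mono

    countBelow-mono-tight : countBelow C ≤ countBelow B → ∀ {S} → F S → S ⊆ C → S ⊆ B
    countBelow-mono-tight #C≤#B {S} FS with ∑-mono-≤-tight isBelow-mono #C≤#B S
    ... | C≤B with F? S
    ...   | yes _  = indicator-mono⁻¹ (S ⊆? C) (S ⊆? B) C≤B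
    ...   | no ¬FS = ⊥-elim (¬FS FS)

Fixed : {n : ℕ} → ChoiceFunction n → Subset n → Set
Fixed f S = f S ≡ S

fixed? : {n : ℕ} (f : ChoiceFunction n) → Decidable (Fixed f)
fixed? f S = ≡-dec _≟ᵇ_ (f S) S

fixedPointCount : {n : ℕ} → ChoiceFunction n → Subset n → ℤ
fixedPointCount f = +_ ∘ countBelow (fixed? f)

module _ {n : ℕ} (f : ChoiceFunction n) (f⊆ : IsCF f) (consistent : Consistent f) (monotonic : Monotonic f) where

  f-fixed : ∀ A → Fixed f (f A)
  f-fixed A = consistent A (f A) ⊆-refl (f⊆ A)

  fixed⊆⇒⊆f : ∀ {A B S} → B ⊆ A → Fixed f S → S ⊆ B → S ⊆ f A
  fixed⊆⇒⊆f {A} B⊆A fS≡S S⊆B = subst (_⊆ f A) fS≡S (monotonic _ A (⊆-trans S⊆B B⊆A))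

  f-isMaximizer : ∀ A → IsMaximizer (fixedPointCount f) A (f A)
  f-isMaximizer A = f⊆ A , λ B B⊆A → +≤+ (countBelow-mono (fixed? f) (fixed⊆⇒⊆f B⊆A))

  f-least : ∀ A M → IsMaximizer (fixedPointCount f) A M → f A ⊆ M
  f-least A M (M⊆A , maximal) =
    countBelow-mono-tight (fixed? f) (fixed⊆⇒⊆f M⊆A) (drop‿+≤+ (maximal (f A) (f⊆ A))) (f-fixed A) ⊆-refl

  fixedPointCount-generates : Generates (fixedPointCount f) f
  fixedPointCount-generates A = f-isMaximizer A , f-least A

theorem3 : (n : ℕ) (f : ChoiceFunction n) → IsCF f → Complementary f →
    Σ (Subset n → ℤ) (λ u → Supermodular u × Generates u f)
theorem3 n f f⊆ (consistent , monotonic) =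
  fixedPointCount f ,
  countBelow-supermodular (fixed? f) ,
  fixedPointCount-generates f f⊆ consistent monotonic
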